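{- Let $n_1,n_2,n_3\ge 2$ and $k\ge 2$. If $P_{n_1}\Box P_{n_2}\Box P_{n_3}$ has a $(k+1)$-resolving set, then $\dim_{k+1}(P_{n_1}\Box P_{n_2}\Box P_{n_3})\ge 2k+2$.
   Context: $P_{n_1}\Box P_{n_2}\Box P_{n_3}$ is the grid graph with vertex set $\{(x_1,x_2,x_3): 0\le x_i\le n_i-1\}$, two vertices adjacent iff they differ by exactly $1$ in exactly one coordinate; $d(x,y)=\sum_i|x_i-y_i|$. A set $S$ of vertices is a $k$-resolving set if every pair of distinct vertices $x,y$ satisfies $d(w,x)\ne d(w,y)$ for at least $k$ vertices $w\in S$. When one exists, $\dim_k$ is the minimum cardinality of a $k$-resolving set. -}

module Defs where

open import Data.Nat using (ℕ; _≤_; _+_; _∸_; _≟_)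
open import Data.Fin using (Fin; toℕ)
open import Data.Product using (_×_; _,_; ∃)
open import Data.List using (List; length; filter)
open import Data.List.Relation.Unary.Unique.Propositional using (Unique)
open import Relation.Nullary using (¬_)
open import Relation.Nullary.Decidable using (¬?)
open import Relation.Binary.PropositionalEquality using (_≡_)

absDiff : ℕ → ℕ → ℕ
absDiff a b = (a ∸ b) + (b ∸ a)

Vertex : ℕ → ℕ → ℕ → Set
Vertex n₁ n₂ n₃ = Fin n₁ × Fin n₂ × Fin n₃

-- graph distance in the grid = L1 distance
dist : ∀ {n₁ n₂ n₃} → Vertex n₁ n₂ n₃ → Vertex n₁ n₂ n₃ → ℕ
dist (x₁ , x₂ , x₃) (y₁ , y₂ , y₃) =
  absDiff (toℕ x₁) (toℕ y₁) + absDiff (toℕ x₂) (toℕ y₂) + absDiff (toℕ x₃) (toℕ y₃)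

resolvers : ∀ {n₁ n₂ n₃} → List (Vertex n₁ n₂ n₃) → Vertex n₁ n₂ n₃ → Vertex n₁ n₂ n₃ → ℕ
resolvers S x y = length (filter (λ w → ¬? (dist w x ≟ dist w y)) S)

IsKResolving : ∀ {n₁ n₂ n₃} → ℕ → List (Vertex n₁ n₂ n₃) → Set
IsKResolving k S = Unique S × (∀ x y → ¬ (x ≡ y) → k ≤ resolvers S x y)

HasKResolving : ℕ → ℕ → ℕ → ℕ → Set
HasKResolving n₁ n₂ n₃ k = ∃ λ (S : List (Vertex n₁ n₂ n₃)) → IsKResolving k S

-- dim_k ≥ m (when a k-resolving set exists): every k-resolving set has at least m elements,
-- i.e. the minimum cardinality of a k-resolving set is ≥ m
DimKAtLeast : ℕ → ℕ → ℕ → ℕ → ℕ → Set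
DimKAtLeast n₁ n₂ n₃ k m = ∀ (S : List (Vertex n₁ n₂ n₃)) → IsKResolving k S → m ≤ length S

-- Fix a path end e with inner neighbour e′ in each of the first two coordinates.  The
-- pair x = (e₁′, e₂, z), y = (e₁, e₂′, z) is resolved by w only if w is at e₁ in the
-- first coordinate but not at e₂ in the second, or vice versa: otherwise both
-- coordinates of w are one step nearer to e (or both to e′) and the two changes of
-- distance cancel.  Taking both ends of each path gives four such pairs; since w lies
-- at no more than one end of each path, it resolves at most two of them.  So a
-- (k+1)-resolving set S satisfies 4(k+1) ≤ 2|S|.
module Submission where

open import Defs
open import Data.Nat using (ℕ; zero; suc; _≤_; _+_; _*_; z≤n; s≤s; _≟_)
open import Data.Nat.Properties
  using ( 0∸n≡0; +-suc; 1+n≢n; ≤-pred; ≤-reflexive; ≤-trans; +-mono-≤; *-cancelʳ-≤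
        ; +-commutativeSemigroup; module ≤-Reasoning )
open import Data.Nat.ListAction using (sum)
open import Data.Nat.Tactic.RingSolver using (solve-∀)
open import Algebra.Properties.CommutativeSemigroup +-commutativeSemigroup using (interchange)
open import Data.Bool using (Bool; true; false; _∧_; _xor_)
open import Data.Fin using (Fin; toℕ; fromℕ; inject₁) renaming (zero to fzero; suc to fsuc)
open import Data.Fin.Properties using (toℕ-fromℕ; toℕ-inject₁; toℕ<n)
open import Data.Product using (_×_; _,_; proj₁; proj₂; uncurry)
open import Data.List using (List; []; _∷_; length; filter; map)
open import Data.List.Relation.Unary.All as All using (All; []; _∷_; universal)
open import Data.List.Relation.Unary.All.Properties using (map⁺)
open import Data.Empty using (⊥-elim)
open import Relation.Nullary using (¬_; Dec; yes; no; does)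
open import Relation.Nullary.Decidable using (¬?)
open import Relation.Unary using (Decidable)
open import Relation.Binary.PropositionalEquality
  using (_≡_; _≢_; refl; sym; trans; cong; cong₂; subst; module ≡-Reasoning)

indicator : Bool → ℕ
indicator true  = 1
indicator false = 0

differ : Bool → Bool → ℕ
differ a b = indicator (a xor b)

indicator≤differ : ∀ {Q : Set} (Q? : Dec Q) a b → (a ≡ b → ¬ Q) → indicator (does Q?) ≤ differ a b
indicator≤differ (no _)  _     _     _ = z≤n
indicator≤differ (yes q) true  true  h = ⊥-elim (h refl q)
indicator≤differ (yes q) false false h = ⊥-elim (h refl q)
indicator≤differ (yes _) true  false _ = s≤s z≤n
indicator≤differ (yes _) false true  _ = s≤s z≤n

length-filter-∷ : ∀ {A : Set} {P : A → Set} (P? : Decidable P) x xs →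
  length (filter P? (x ∷ xs)) ≡ indicator (does (P? x)) + length (filter P? xs)
length-filter-∷ P? x xs with does (P? x)
... | true  = refl
... | false = refl

length*≤sum : ∀ {A : Set} {m} (f : A → ℕ) xs → All (λ x → m ≤ f x) xs → length xs * m ≤ sum (map f xs)
length*≤sum f []       []         = z≤n
length*≤sum f (x ∷ xs) (mx ∷ mxs) = +-mono-≤ mx (length*≤sum f xs mxs)

Nearer : ℕ → ℕ → ℕ → Set
Nearer u a b = absDiff u b ≡ suc (absDiff u a)

NearerSide : Bool → ℕ → ℕ → ℕ → Set
NearerSide true  u e e′ = Nearer u e e′
NearerSide false u e e′ = Nearer u e′ e

nearerSide-irrefl : ∀ s {u a} → ¬ NearerSide s u a a
nearerSide-irrefl true  eq = 1+n≢n (sym eq)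
nearerSide-irrefl false eq = 1+n≢n (sym eq)

nearerSide-suc : ∀ s {u e e′} → NearerSide s u e e′ → NearerSide s (suc u) (suc e) (suc e′)
nearerSide-suc true  p = p
nearerSide-suc false p = p

nearerSide-zero : ∀ u → NearerSide (does (u ≟ 0)) u 0 1
nearerSide-zero zero    = refl
nearerSide-zero (suc u) = cong suc (cong (u +_) (sym (0∸n≡0 u)))

nearerSide-top : ∀ u m → u ≤ suc m → NearerSide (does (u ≟ suc m)) u (suc m) m
nearerSide-top zero          zero    _       = refl
nearerSide-top zero          (suc m) _       = refl
nearerSide-top (suc zero)    zero    _       = refl
nearerSide-top (suc (suc u)) zero    (s≤s ())
nearerSide-top (suc u)       (suc m) (s≤s p) = nearerSide-suc (does (u ≟ suc m)) (nearerSide-top u m p)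

nearer-swap : ∀ {u a b v c d} → Nearer u a b → Nearer v c d →
  absDiff u b + absDiff v c ≡ absDiff u a + absDiff v d
nearer-swap {u} {a} {b} {v} {c} {d} p q = begin
  absDiff u b + absDiff v c        ≡⟨ cong (_+ absDiff v c) p ⟩
  suc (absDiff u a) + absDiff v c  ≡⟨ +-suc (absDiff u a) (absDiff v c) ⟨
  absDiff u a + suc (absDiff v c)  ≡⟨ cong (absDiff u a +_) q ⟨
  absDiff u a + absDiff v d        ∎
  where open ≡-Reasoning

nearerSide-swap : ∀ s u e e′ v f f′ → NearerSide s u e e′ → NearerSide s v f f′ →
  absDiff u e′ + absDiff v f ≡ absDiff u e + absDiff v f′
nearerSide-swap true  u e e′ v f f′ p q = nearer-swap {u} {e} {e′} {v} {f} {f′} p q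
nearerSide-swap false u e e′ v f f′ p q = sym (nearer-swap {u} {e′} {e} {v} {f′} {f} p q)

atEnd : ∀ {n} → Fin n → Fin n → Bool
atEnd u e = does (toℕ u ≟ toℕ e)

does-∧ : ∀ {A B : Set} (A? : Dec A) (B? : Dec B) → ¬ (A × B) → does A? ∧ does B? ≡ false
does-∧ (no _)  _       _ = refl
does-∧ (yes _) (no _)  _ = refl
does-∧ (yes a) (yes b) h = ⊥-elim (h (a , b))

atEnd-∧ : ∀ {n} (u : Fin n) {e e′ : Fin n} → toℕ e ≢ toℕ e′ → atEnd u e ∧ atEnd u e′ ≡ false
atEnd-∧ u {e} {e′} e≢e′ =
  does-∧ (toℕ u ≟ toℕ e) (toℕ u ≟ toℕ e′) (λ (p , q) → e≢e′ (trans (sym p) q))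

-- Only the end itself is nearer to it than to its neighbour.
record PathEnd (n : ℕ) : Set where
  field
    end neighbour : Fin n
    nearerSide : ∀ u → NearerSide (atEnd u end) (toℕ u) (toℕ end) (toℕ neighbour)

open PathEnd

end≢neighbour : ∀ {n} (E : PathEnd n) → end E ≢ neighbour E
end≢neighbour E eq = nearerSide-irrefl _
  (subst (λ e → NearerSide (atEnd (end E) (end E)) (toℕ (end E)) (toℕ e) (toℕ (neighbour E)))
         eq (nearerSide E (end E)))

lowEnd : ∀ {m} → PathEnd (suc (suc m))
lowEnd = record { end = fzero ; neighbour = fsuc fzero ; nearerSide = λ u → nearerSide-zero (toℕ u) }

highEnd : ∀ {m} → PathEnd (suc (suc m))
highEnd {m} = record
  { end = fromℕ (suc m) ; neighbour = inject₁ (fromℕ m) ; nearerSide = nearerSide-high }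
  where
  nearerSide-high : ∀ u → NearerSide (atEnd u (fromℕ (suc m))) (toℕ u)
                                     (toℕ (fromℕ (suc m))) (toℕ (inject₁ (fromℕ m)))
  nearerSide-high u rewrite toℕ-inject₁ (fromℕ m) | toℕ-fromℕ m =
    nearerSide-top (toℕ u) m (≤-pred (toℕ<n u))

module _ {n₁ n₂ n₃ : ℕ} where

  V : Set
  V = Vertex n₁ n₂ n₃

  cornerPair : PathEnd n₁ → PathEnd n₂ → Fin n₃ → V × V
  cornerPair E₁ E₂ z = (neighbour E₁ , end E₂ , z) , (end E₁ , neighbour E₂ , z)

  cornerPair-distinct : ∀ E₁ E₂ z → proj₁ (cornerPair E₁ E₂ z) ≢ proj₂ (cornerPair E₁ E₂ z)
  cornerPair-distinct E₁ E₂ z eq = end≢neighbour E₁ (sym (cong proj₁ eq))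

  cornerPair-equidistant : ∀ E₁ E₂ z ((w₁ , w₂ , w₃) : V) →
    atEnd w₁ (end E₁) ≡ atEnd w₂ (end E₂) →
    dist (w₁ , w₂ , w₃) (proj₁ (cornerPair E₁ E₂ z)) ≡ dist (w₁ , w₂ , w₃) (proj₂ (cornerPair E₁ E₂ z))
  cornerPair-equidistant E₁ E₂ z (w₁ , w₂ , w₃) sameSide =
    cong (_+ absDiff (toℕ w₃) (toℕ z))
      (nearerSide-swap (atEnd w₂ (end E₂)) (toℕ w₁) (toℕ (end E₁)) (toℕ (neighbour E₁))
                       (toℕ w₂) (toℕ (end E₂)) (toℕ (neighbour E₂))
                       (subst (λ s → NearerSide s (toℕ w₁) (toℕ (end E₁)) (toℕ (neighbour E₁))) sameSide
                              (nearerSide E₁ w₁))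
                       (nearerSide E₂ w₂))

  resolves? : (w x y : V) → Dec (dist w x ≢ dist w y)
  resolves? w x y = ¬? (dist w x ≟ dist w y)

  resolvedPairs : V → List (V × V) → ℕ
  resolvedPairs w ps = sum (map (λ (x , y) → indicator (does (resolves? w x y))) ps)

  resolvers-∷ : ∀ w S x y → resolvers (w ∷ S) x y ≡ indicator (does (resolves? w x y)) + resolvers S x y
  resolvers-∷ w S x y = length-filter-∷ (λ v → resolves? v x y) w S

  sum-resolvers-∷ : ∀ w S ps →
    sum (map (uncurry (resolvers (w ∷ S))) ps) ≡ resolvedPairs w ps + sum (map (uncurry (resolvers S)) ps)
  sum-resolvers-∷ w S []             = refl
  sum-resolvers-∷ w S ((x , y) ∷ ps) = begin
    resolvers (w ∷ S) x y + sum (map (uncurry (resolvers (w ∷ S))) ps)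
      ≡⟨ cong₂ _+_ (resolvers-∷ w S x y) (sum-resolvers-∷ w S ps) ⟩
    (indicator (does (resolves? w x y)) + resolvers S x y)
      + (resolvedPairs w ps + sum (map (uncurry (resolvers S)) ps))
      ≡⟨ interchange (indicator (does (resolves? w x y))) (resolvers S x y) (resolvedPairs w ps) _ ⟩
    (indicator (does (resolves? w x y)) + resolvedPairs w ps)
      + (resolvers S x y + sum (map (uncurry (resolvers S)) ps))
      ∎
    where open ≡-Reasoning

  sum-resolvers-[] : ∀ ps → sum (map (uncurry (resolvers {n₁} {n₂} {n₃} [])) ps) ≡ 0
  sum-resolvers-[] []      = refl
  sum-resolvers-[] (_ ∷ ps) = sum-resolvers-[] ps

  sum-resolvers≤ : ∀ {c} S ps → (∀ w → resolvedPairs w ps ≤ c) →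
    sum (map (uncurry (resolvers S)) ps) ≤ length S * c
  sum-resolvers≤ [] ps _ = ≤-reflexive (sum-resolvers-[] ps)
  sum-resolvers≤ {c} (w ∷ S) ps bound = begin
    sum (map (uncurry (resolvers (w ∷ S))) ps)                 ≡⟨ sum-resolvers-∷ w S ps ⟩
    resolvedPairs w ps + sum (map (uncurry (resolvers S)) ps)
      ≤⟨ +-mono-≤ (bound w) (sum-resolvers≤ S ps bound) ⟩
    c + length S * c                                           ∎
    where open ≤-Reasoning

  resolvedPairs-corners≤ : ∀ z ((w₁ , w₂ , w₃) : V) (Es : List (PathEnd n₁ × PathEnd n₂)) →
    resolvedPairs (w₁ , w₂ , w₃) (map (λ (E₁ , E₂) → cornerPair E₁ E₂ z) Es)
      ≤ sum (map (λ (E₁ , E₂) → differ (atEnd w₁ (end E₁)) (atEnd w₂ (end E₂))) Es)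
  resolvedPairs-corners≤ z w [] = z≤n
  resolvedPairs-corners≤ z (w₁ , w₂ , w₃) ((E₁ , E₂) ∷ Es) =
    +-mono-≤ (indicator≤differ (uncurry (resolves? (w₁ , w₂ , w₃)) (cornerPair E₁ E₂ z))
                               (atEnd w₁ (end E₁)) (atEnd w₂ (end E₂))
               (λ sameSide resolved → resolved (cornerPair-equidistant E₁ E₂ z (w₁ , w₂ , w₃) sameSide)))
             (resolvedPairs-corners≤ z (w₁ , w₂ , w₃) Es)

  resolving-double-count : ∀ {k c} S ps → IsKResolving k S → All (λ (x , y) → x ≢ y) ps →
    (∀ w → resolvedPairs w ps ≤ c) → length ps * k ≤ length S * c
  resolving-double-count {k} {c} S ps (_ , resolves) distinct bound = begin
    length ps * k
      ≤⟨ length*≤sum (uncurry (resolvers S)) ps (All.map (λ {(x , y)} → resolves x y) distinct) ⟩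
    sum (map (uncurry (resolvers S)) ps)  ≤⟨ sum-resolvers≤ S ps bound ⟩
    length S * c                          ∎
    where open ≤-Reasoning

differ-corners≤2 : ∀ a b c d → a ∧ b ≡ false → c ∧ d ≡ false →
  sum (differ a c ∷ differ a d ∷ differ b c ∷ differ b d ∷ []) ≤ 2
differ-corners≤2 true  true  _     _     ()
differ-corners≤2 _     _     true  true  _ ()
differ-corners≤2 true  false true  false _ _ = s≤s (s≤s z≤n)
differ-corners≤2 true  false false true  _ _ = s≤s (s≤s z≤n)
differ-corners≤2 true  false false false _ _ = s≤s (s≤s z≤n)
differ-corners≤2 false true  true  false _ _ = s≤s (s≤s z≤n)
differ-corners≤2 false true  false true  _ _ = s≤s (s≤s z≤n)
differ-corners≤2 false true  false false _ _ = s≤s (s≤s z≤n)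
differ-corners≤2 false false true  false _ _ = s≤s (s≤s z≤n)
differ-corners≤2 false false false true  _ _ = s≤s (s≤s z≤n)
differ-corners≤2 false false false false _ _ = z≤n

module _ {m₁ m₂ n₃ : ℕ} (z : Fin n₃) where

  cornerEnds : List (PathEnd (suc (suc m₁)) × PathEnd (suc (suc m₂)))
  cornerEnds = (lowEnd , lowEnd) ∷ (lowEnd , highEnd) ∷ (highEnd , lowEnd) ∷ (highEnd , highEnd) ∷ []

  corners : List (V × V)
  corners = map (λ (E₁ , E₂) → cornerPair E₁ E₂ z) cornerEnds

  corners-distinct : All (λ (x , y) → x ≢ y) corners
  corners-distinct = map⁺ (universal (λ (E₁ , E₂) → cornerPair-distinct E₁ E₂ z) cornerEnds)

  resolvedPairs-corners≤2 : ∀ w → resolvedPairs w corners ≤ 2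
  resolvedPairs-corners≤2 (w₁ , w₂ , w₃) =
    ≤-trans (resolvedPairs-corners≤ z (w₁ , w₂ , w₃) cornerEnds)
            (differ-corners≤2 (atEnd w₁ (end lowEnd)) (atEnd w₁ (end highEnd))
                              (atEnd w₂ (end lowEnd)) (atEnd w₂ (end highEnd))
                              (atEnd-∧ w₁ λ ()) (atEnd-∧ w₂ λ ()))

four-corners : ∀ k → 4 * (k + 1) ≡ (2 * k + 2) * 2
four-corners = solve-∀

proposition14 : (n₁ n₂ n₃ k : ℕ) → 2 ≤ n₁ → 2 ≤ n₂ → 2 ≤ n₃ → 2 ≤ k →
    HasKResolving n₁ n₂ n₃ (k + 1) → DimKAtLeast n₁ n₂ n₃ (k + 1) (2 * k + 2)
proposition14 (suc (suc m₁)) (suc (suc m₂)) (suc m₃) k (s≤s (s≤s _)) (s≤s (s≤s _)) (s≤s _) _ _ S S-resolving =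
  *-cancelʳ-≤ (2 * k + 2) (length S) 2
    (subst (_≤ length S * 2) (four-corners k)
      (resolving-double-count S (corners fzero) S-resolving
                              (corners-distinct fzero) (resolvedPairs-corners≤2 fzero)))
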